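{- If a core graph contains an induced $C_5$, then it has at most ten vertices.
   Context: All graphs are finite and simple. For a graph $G$, let $P(G)$ be the polytope in $\mathbb{R}^{V(G)}$ defined by $0\le x_v\le 1$ for every vertex $v$, $x_u+x_v\le 1$ for every edge $uv$, and $\sum_{v\in V(C)}x_v\le (|V(C)|-1)/2$ for every induced odd cycle $C$. $G$ is t-perfect if $P(G)$ equals the convex hull of characteristic vectors of independent sets of $G$, t-imperfect otherwise. If $N(v)$ is an independent set, the t-contraction at $v$ contracts $N(v)\cup\{v\}$ into a single vertex. A t-minor of $G$ is a graph obtained by a sequence of vertex deletions and t-contractions; it is proper if it has fewer vertices than $G$. A graph $G$ is a core graph if neither $G$ nor its complement $\overline{G}$ has a t-imperfect proper t-minor. -}

module Defs where

open import Data.Nat as ℕ using (ℕ; zero; suc; _%_; _∸_)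
open import Data.Fin using (Fin; toℕ)
open import Data.Fin.Properties using (_≟_)
open import Data.Bool using (Bool; true; false; not; if_then_else_)
open import Data.Integer using (+_)
open import Data.Rational using (ℚ; 0ℚ; 1ℚ; _+_; _*_; _≤_; _/_)
open import Data.List using (List; []; _∷_)
open import Data.Product using (Σ; _×_; _,_; ∃; ∃-syntax)
open import Data.Sum using (_⊎_)
open import Function.Definitions using (Injective; Surjective)
open import Relation.Binary.PropositionalEquality using (_≡_; _≢_)
open import Relation.Nullary using (yes; no)
open import Function.Bundles using (_⇔_)

record Graph (n : ℕ) : Set where
  field
    adj   : Fin n → Fin n → Bool
    adj-sym : ∀ u v → adj u v ≡ adj v u
    adj-irr : ∀ v → adj v v ≡ false
open Graph public

Adj : ∀ {n} → Graph n → Fin n → Fin n → Set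
Adj G u v = adj G u v ≡ true

complement : ∀ {n} → Graph n → Graph n
complement {n} G = record { adj = cadj ; adj-sym = csym ; adj-irr = cirr }
  where
  cadj : Fin n → Fin n → Bool
  cadj u v with u ≟ v
  ... | yes _ = false
  ... | no  _ = not (adj G u v)
  open import Relation.Binary.PropositionalEquality using (refl) renaming (sym to ≡sym)
  csym : ∀ u v → cadj u v ≡ cadj v u
  csym u v with u ≟ v | v ≟ u
  ... | yes _ | yes _ = refl
  ... | yes p | no q = Data.Empty.⊥-elim (q (≡sym p)) where import Data.Empty
  ... | no p | yes q = Data.Empty.⊥-elim (p (≡sym q)) where import Data.Empty
  ... | no _ | no _ rewrite Graph.adj-sym G u v = refl
  cirr : ∀ v → cadj v v ≡ false
  cirr v with v ≟ v
  ... | yes _ = refl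
  ... | no p = Data.Empty.⊥-elim (p refl) where import Data.Empty

Consec : (k : ℕ) → Fin (suc k) → Fin (suc k) → Set
Consec k i j = (suc (toℕ i) % suc k ≡ toℕ j) ⊎ (suc (toℕ j) % suc k ≡ toℕ i)

-- an induced cycle of length (suc k) in G, given by an injective
-- enumeration c of its vertices in cyclic order
IsInducedCycle : ∀ {n} → Graph n → (k : ℕ) → (Fin (suc k) → Fin n) → Set
IsInducedCycle G k c =
  (3 ℕ.≤ suc k) × Injective _≡_ _≡_ c × (∀ i j → Adj G (c i) (c j) ⇔ Consec k i j)

Odd : ℕ → Set
Odd m = m % 2 ≡ 1

sumFin : ∀ {k} → (Fin k → ℚ) → ℚ
sumFin {zero}  f = 0ℚ
sumFin {suc k} f = f Fin.zero + sumFin (λ i → f (Fin.suc i))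
  where import Data.Fin as Fin

InP : ∀ {n} → Graph n → (Fin n → ℚ) → Set
InP {n} G x =
  (∀ v → 0ℚ ≤ x v) × (∀ v → x v ≤ 1ℚ) ×
  (∀ u v → Adj G u v → x u + x v ≤ 1ℚ) ×
  (∀ (k : ℕ) (c : Fin (suc k) → Fin n) → Odd (suc k) → IsInducedCycle G k c →
     sumFin (λ i → x (c i)) ≤ (+ k) / 2)

Independent : ∀ {n} → Graph n → (Fin n → Bool) → Set
Independent G S = ∀ u v → S u ≡ true → S v ≡ true → adj G u v ≡ false

χ : ∀ {n} → (Fin n → Bool) → Fin n → ℚ
χ S v = if S v then 1ℚ else 0ℚ

combo : ∀ {n} → List (ℚ × (Fin n → Bool)) → Fin n → ℚ
combo [] v = 0ℚ
combo ((w , S) ∷ ws) v = w * χ S v + combo ws v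

weightSum : ∀ {n} → List (ℚ × (Fin n → Bool)) → ℚ
weightSum [] = 0ℚ
weightSum ((w , _) ∷ ws) = w + weightSum ws

data AllOK {n} (G : Graph n) : List (ℚ × (Fin n → Bool)) → Set where
  []  : AllOK G []
  _∷_ : ∀ {w S ws} → (0ℚ ≤ w) × Independent G S → AllOK G ws → AllOK G ((w , S) ∷ ws)

InSTAB : ∀ {n} → Graph n → (Fin n → ℚ) → Set
InSTAB G x = Σ _ λ ws → AllOK G ws × weightSum ws ≡ 1ℚ × (∀ v → x v ≡ combo ws v)

TPerfect : ∀ {n} → Graph n → Set
TPerfect G = ∀ x → InP G x ⇔ InSTAB G x

-- H is (an isomorphic copy of) G - v
IsDeletion : ∀ {n m} → Graph n → Fin n → Graph m → Set
IsDeletion {n} {m} G v H =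
  Σ (Fin m → Fin n) λ f → Injective _≡_ _≡_ f ×
    (∀ u → u ≢ v → ∃[ i ] f i ≡ u) × (∀ i → f i ≢ v) ×
    (∀ i j → adj H i j ≡ adj G (f i) (f j))

InClosedNbhd : ∀ {n} → Graph n → Fin n → Fin n → Set
InClosedNbhd G v a = (a ≡ v) ⊎ Adj G v a

-- H is (an isomorphic copy of) the t-contraction of G at v:
-- N(v) is independent and N[v] is contracted to a single vertex
IsTContraction : ∀ {n m} → Graph n → Fin n → Graph m → Set
IsTContraction {n} {m} G v H =
  (∀ a b → Adj G v a → Adj G v b → adj G a b ≡ false) ×
  Σ (Fin n → Fin m) λ f → Surjective _≡_ _≡_ f ×
    (∀ a b → (f a ≡ f b) ⇔ ((a ≡ b) ⊎ (InClosedNbhd G v a × InClosedNbhd G v b))) ×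
    (∀ a b → f a ≢ f b →
       Adj H (f a) (f b) ⇔ (∃[ a' ] ∃[ b' ] (f a' ≡ f a × f b' ≡ f b × Adj G a' b')))

data TMinor {n} (G : Graph n) : ∀ {m} → Graph m → Set where
  here  : TMinor G G
  del   : ∀ {m k} {H : Graph m} {K : Graph k} (v : Fin m) →
          TMinor G H → IsDeletion H v K → TMinor G K
  contr : ∀ {m k} {H : Graph m} {K : Graph k} (v : Fin m) →
          TMinor G H → IsTContraction H v K → TMinor G K

NoTImperfectProperTMinor : ∀ {n} → Graph n → Set
NoTImperfectProperTMinor {n} G =
  ∀ {m} (H : Graph m) → TMinor G H → m ℕ.< n → TPerfect H

IsCore : ∀ {n} → Graph n → Set
IsCore G = NoTImperfectProperTMinor G × NoTImperfectProperTMinor (complement G)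

ContainsInducedC5 : ∀ {n} → Graph n → Set
ContainsInducedC5 G = ∃[ c ] IsInducedCycle G 4 c

{-# OPTIONS --safe #-}
-- The constant vector 1/3 lies in P(H) for every graph H, since an odd cycle of length
-- k ≥ 3 has k/3 ≤ (k-1)/2.  When H is t-perfect, 1/3 is then a convex combination of
-- independent sets, so averaging gives an independent set of size at least |V(H)|/3.
-- In particular a t-perfect complete graph has at most 3 vertices.
--
-- Let G be a core graph on m + 1 vertices and v a vertex.  Then G - v is t-perfect, so
-- it has an independent set S with m ≤ 3|S|.  In the complement, S is a clique, and the
-- complete graph induced on it is a proper t-minor of the complement of G, hence
-- t-perfect; so |S| ≤ 3 and m ≤ 9.
module Submission where

open import Defs
open import Data.Nat using (ℕ; _≤_)

open import Algebra.Bundles using (Ring)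
open import Data.Bool.Base using (Bool; true; false; not; if_then_else_)
open import Data.Bool.Properties as Bool using (¬-not)
open import Data.Fin.Base using (Fin; zero; suc; punchIn; punchOut)
import Data.Fin.Properties as Fin
open import Data.Integer.Base as ℤ using (+_)
open import Data.Integer.Tactic.RingSolver using (solve-∀)
open import Data.List.Base using (List; []; _∷_)
open import Data.List.Relation.Unary.All as All using (All; []; _∷_; lookupAny)
open import Data.List.Relation.Unary.All.Properties using (¬Any⇒All¬)
open import Data.List.Relation.Unary.Any using (any?)
open import Data.Nat.Base as ℕ using (zero; suc; z≤n; s≤s; _*_)
import Data.Nat.Properties as ℕₚ
open import Data.Product using (Σ; _×_; _,_; proj₁; proj₂; ∃-syntax)
open import Data.Rational as ℚ using (ℚ; 0ℚ; 1ℚ; ½; _/_; toℚᵘ)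
import Data.Rational.Properties as ℚₚ
import Data.Rational.Unnormalised as ℚᵘ
import Data.Rational.Unnormalised.Properties as ℚᵘₚ
open import Function.Base using (_∘_; id)
open import Function.Bundles using (Equivalence)
open import Function.Definitions using (Injective)
open import Relation.Binary.PropositionalEquality
open import Relation.Nullary using (¬_; yes; no; contradiction)

open import Algebra.Properties.Semiring.Sum (Ring.semiring ℚₚ.+-*-ring)
  using (sum; ∑-distrib-+; *-distribˡ-sum; sum-cong-≗; sum-replicate; sum-replicate-zero)
open import Algebra.Properties.Monoid.Mult ℚₚ.+-0-monoid
  using (×-assocˡ) renaming (_×_ to _·_)

⅓ : ℚ
⅓ = + 1 / 3

0≤⅓ : 0ℚ ℚ.≤ ⅓
0≤⅓ = ℚₚ.≤ᵇ⇒≤ _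

sumFin-const : ∀ k x → sumFin {k} (λ _ → x) ≡ k · x
sumFin-const zero    x = refl
sumFin-const (suc k) x = cong (x ℚ.+_) (sumFin-const k x)

·-monoˡ-≤ : ∀ {x a b} → 0ℚ ℚ.≤ x → a ≤ b → a · x ℚ.≤ b · x
·-monoˡ-≤ {b = zero}  0≤x z≤n     = ℚₚ.≤-refl
·-monoˡ-≤ {b = suc b} 0≤x z≤n     = ℚₚ.+-mono-≤ 0≤x (·-monoˡ-≤ {b = b} 0≤x z≤n)
·-monoˡ-≤ {x}         0≤x (s≤s p) = ℚₚ.+-monoʳ-≤ x (·-monoˡ-≤ 0≤x p)

[1+k]/2≡½+k/2 : ∀ k → + suc k / 2 ≡ ½ ℚ.+ + k / 2
[1+k]/2≡½+k/2 k = ℚₚ.toℚᵘ-injective (begin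
    toℚᵘ (+ suc k / 2)           ≈⟨ ℚₚ.toℚᵘ-fromℚᵘ (ℚᵘ.mkℚᵘ (+ suc k) 1) ⟩
    ℚᵘ.mkℚᵘ (+ suc k) 1          ≈⟨ ℚᵘ.*≡* (cross-multiplied (+ k)) ⟩
    toℚᵘ ½ ℚᵘ.+ ℚᵘ.mkℚᵘ (+ k) 1   ≈⟨ ℚᵘₚ.+-congʳ (toℚᵘ ½) (ℚᵘₚ.≃-sym (ℚₚ.toℚᵘ-fromℚᵘ (ℚᵘ.mkℚᵘ (+ k) 1))) ⟩
    toℚᵘ ½ ℚᵘ.+ toℚᵘ (+ k / 2)    ≈⟨ ℚᵘₚ.≃-sym (ℚₚ.toℚᵘ-homo-+ ½ (+ k / 2)) ⟩
    toℚᵘ (½ ℚ.+ + k / 2)          ∎)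
  where
  open ℚᵘₚ.≃-Reasoning
  cross-multiplied : ∀ x → (+ 1 ℤ.+ x) ℤ.* + 4 ≡ (+ 2 ℤ.+ x ℤ.* + 2) ℤ.* + 2
  cross-multiplied = solve-∀

[3+j]·⅓≤[2+j]/2 : ∀ j → (3 ℕ.+ j) · ⅓ ℚ.≤ + (2 ℕ.+ j) / 2
[3+j]·⅓≤[2+j]/2 zero    = ℚₚ.≤ᵇ⇒≤ _
[3+j]·⅓≤[2+j]/2 (suc j) = begin
  ⅓ ℚ.+ (3 ℕ.+ j) · ⅓        ≤⟨ ℚₚ.+-mono-≤ (ℚₚ.≤ᵇ⇒≤ {⅓} {½} _) ([3+j]·⅓≤[2+j]/2 j) ⟩
  ½ ℚ.+ + (2 ℕ.+ j) / 2      ≡⟨ [1+k]/2≡½+k/2 (2 ℕ.+ j) ⟨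
  + (3 ℕ.+ j) / 2            ∎
  where open ℚₚ.≤-Reasoning

⅓∈P : ∀ {n} (G : Graph n) → InP G (λ _ → ⅓)
⅓∈P G = (λ _ → 0≤⅓) , (λ _ → ℚₚ.≤ᵇ⇒≤ _) , (λ _ _ _ → ℚₚ.≤ᵇ⇒≤ _) , odd-cycle
  where
  odd-cycle : ∀ k c → Odd (suc k) → IsInducedCycle G k c → sumFin {suc k} (λ _ → ⅓) ℚ.≤ + k / 2
  odd-cycle (suc (suc j)) _ _ (s≤s (s≤s (s≤s z≤n)) , _) =
    subst (ℚ._≤ + (2 ℕ.+ j) / 2) (sym (sumFin-const (3 ℕ.+ j) ⅓)) ([3+j]·⅓≤[2+j]/2 j)

size : ∀ {n} → (Fin n → Bool) → ℕ
size {zero}  S = 0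
size {suc n} S = if S zero then suc (size (S ∘ suc)) else size (S ∘ suc)

size≤n : ∀ {n} (S : Fin n → Bool) → size S ≤ n
size≤n {zero}  S = z≤n
size≤n {suc n} S with S zero
... | true  = s≤s (size≤n (S ∘ suc))
... | false = ℕₚ.m≤n⇒m≤1+n (size≤n (S ∘ suc))

size-empty : ∀ {n} (S : Fin n → Bool) → (∀ i → S i ≡ false) → size S ≡ 0
size-empty {zero}  S empty = refl
size-empty {suc n} S empty rewrite empty zero = size-empty (S ∘ suc) (empty ∘ suc)

size-subsingleton : ∀ {n} (S : Fin n → Bool) → (∀ u v → S u ≡ true → S v ≡ true → u ≡ v) → size S ≤ 1
size-subsingleton {zero}  S unique = z≤n
size-subsingleton {suc n} S unique with S zero in S0
... | true  = s≤s (ℕₚ.≤-reflexive (size-empty (S ∘ suc) (λ i → ¬-not (Fin.0≢1+n ∘ unique zero (suc i) S0))))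
... | false = size-subsingleton (S ∘ suc) (λ u v Su Sv → Fin.suc-injective (unique (suc u) (suc v) Su Sv))

size-punchIn : ∀ {n} (S : Fin (suc n) → Bool) v → S v ≡ false → size S ≡ size (S ∘ punchIn v)
size-punchIn S zero Sv rewrite Sv = refl
size-punchIn {suc n} S (suc v) Sv =
  cong (λ s → if S zero then suc s else s) (size-punchIn (S ∘ suc) v Sv)

sum-χ : ∀ {n} (S : Fin n → Bool) → sum (χ S) ≡ size S · 1ℚ
sum-χ {zero}  S = refl
sum-χ {suc n} S with S zero
... | true  = cong (1ℚ ℚ.+_) (sum-χ (S ∘ suc))
... | false = trans (ℚₚ.+-identityˡ _) (sum-χ (S ∘ suc))

3a≤b⇒a≤b·⅓ : ∀ {a b} → 3 * a ≤ b → a · 1ℚ ℚ.≤ b · ⅓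
3a≤b⇒a≤b·⅓ {a} {b} 3a≤b = begin
  a · 1ℚ          ≡⟨ ×-assocˡ ⅓ a 3 ⟩
  (a * 3) · ⅓     ≡⟨ cong (_· ⅓) (ℕₚ.*-comm a 3) ⟩
  (3 * a) · ⅓     ≤⟨ ·-monoˡ-≤ 0≤⅓ 3a≤b ⟩
  b · ⅓           ∎
  where open ℚₚ.≤-Reasoning

sum-combo≤ : ∀ {n r} (ws : List (ℚ × (Fin n → Bool))) →
             All (λ p → 0ℚ ℚ.≤ proj₁ p) ws → All (λ p → size (proj₂ p) · 1ℚ ℚ.≤ r) ws →
             sum (combo ws) ℚ.≤ r ℚ.* weightSum ws
sum-combo≤ {n} {r} [] [] [] = ℚₚ.≤-reflexive (trans (sum-replicate-zero n) (sym (ℚₚ.*-zeroʳ r)))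
sum-combo≤ {r = r} ((w , S) ∷ ws) (0≤w ∷ 0≤ws) (S≤r ∷ ws≤r) = begin
  sum (combo ((w , S) ∷ ws))               ≡⟨ ∑-distrib-+ (λ v → w ℚ.* χ S v) (combo ws) ⟩
  sum (λ v → w ℚ.* χ S v) ℚ.+ sum (combo ws) ≡⟨ cong (ℚ._+ sum (combo ws)) (*-sum-χ) ⟩
  w ℚ.* (size S · 1ℚ) ℚ.+ sum (combo ws)   ≤⟨ ℚₚ.+-mono-≤ (ℚₚ.*-monoˡ-≤-nonNeg w {{ℚ.nonNegative 0≤w}} S≤r)
                                                        (sum-combo≤ ws 0≤ws ws≤r) ⟩
  w ℚ.* r ℚ.+ r ℚ.* weightSum ws           ≡⟨ cong (ℚ._+ r ℚ.* weightSum ws) (ℚₚ.*-comm w r) ⟩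
  r ℚ.* w ℚ.+ r ℚ.* weightSum ws           ≡⟨ ℚₚ.*-distribˡ-+ r w (weightSum ws) ⟨
  r ℚ.* (w ℚ.+ weightSum ws)               ∎
  where
  open ℚₚ.≤-Reasoning
  *-sum-χ : sum (λ v → w ℚ.* χ S v) ≡ w ℚ.* (size S · 1ℚ)
  *-sum-χ = trans (sym (*-distribˡ-sum w (χ S))) (cong (w ℚ.*_) (sum-χ S))

AllOK⇒All : ∀ {n} {G : Graph n} {ws} → AllOK G ws →
            All (λ p → 0ℚ ℚ.≤ proj₁ p × Independent G (proj₂ p)) ws
AllOK⇒All []       = []
AllOK⇒All (p ∷ ps) = p ∷ AllOK⇒All ps

tPerfect⇒largeIndependentSet : ∀ {n} (G : Graph n) → TPerfect G →
                               ∃[ S ] Independent G S × n ≤ 3 * size S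
tPerfect⇒largeIndependentSet {zero} G _ = (λ _ → false) , (λ ()) , z≤n
tPerfect⇒largeIndependentSet {suc n} G t-perfect
  with ws , ok , total , ⅓≡combo ← Equivalence.to (t-perfect (λ _ → ⅓)) (⅓∈P G)
  with any? (λ p → suc n ℕₚ.≤? 3 * size (proj₂ p)) ws
... | yes large = let (_ , independent) , big = lookupAny (AllOK⇒All ok) large in _ , independent , big
... | no ¬large = contradiction (ℚₚ.<-≤-trans r<⅓+r ⅓+r≤r) (ℚₚ.<-irrefl refl)
  where
  open ℚₚ.≤-Reasoning
  r : ℚ
  r = n · ⅓
  small : ∀ {p : ℚ × (Fin (suc n) → Bool)} → ¬ (suc n ≤ 3 * size (proj₂ p)) → size (proj₂ p) · 1ℚ ℚ.≤ r
  small {_ , S} ¬large = 3a≤b⇒a≤b·⅓ {size S} (ℕₚ.≤-pred (ℕₚ.≰⇒> ¬large))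
  r<⅓+r : r ℚ.< ⅓ ℚ.+ r
  r<⅓+r = subst (ℚ._< ⅓ ℚ.+ r) (ℚₚ.+-identityˡ r) (ℚₚ.+-mono-<-≤ (ℚₚ.positive⁻¹ ⅓) (ℚₚ.≤-refl {r}))
  ⅓+r≤r : ⅓ ℚ.+ r ℚ.≤ r
  ⅓+r≤r = begin
    suc n · ⅓              ≡⟨ sum-replicate (suc n) {⅓} ⟨
    sum {suc n} (λ _ → ⅓)  ≡⟨ sum-cong-≗ ⅓≡combo ⟩
    sum (combo ws)         ≤⟨ sum-combo≤ {r = r} ws (All.map proj₁ (AllOK⇒All ok))
                                (All.map (λ {p} → small {p}) (¬Any⇒All¬ ws ¬large)) ⟩
    r ℚ.* weightSum ws     ≡⟨ cong (r ℚ.*_) total ⟩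
    r ℚ.* 1ℚ               ≡⟨ ℚₚ.*-identityʳ r ⟩
    r                      ∎

IsComplete : ∀ {n} → Graph n → Set
IsComplete G = ∀ u v → u ≢ v → Adj G u v

complete-tPerfect⇒≤3 : ∀ {n} (G : Graph n) → IsComplete G → TPerfect G → n ≤ 3
complete-tPerfect⇒≤3 G complete t-perfect
  with S , independent , n≤3|S| ← tPerfect⇒largeIndependentSet G t-perfect
  = ℕₚ.≤-trans n≤3|S| (ℕₚ.*-monoʳ-≤ 3 (size-subsingleton S unique))
  where
  unique : ∀ u v → S u ≡ true → S v ≡ true → u ≡ v
  unique u v Su Sv with u Fin.≟ v
  ... | yes u≡v = u≡v
  ... | no  u≢v = contradiction (trans (sym (complete u v u≢v)) (independent u v Su Sv)) λ ()

_∘ᴳ_ : ∀ {n k} → Graph n → (Fin k → Fin n) → Graph k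
G ∘ᴳ e = record
  { adj     = λ i j → adj G (e i) (e j)
  ; adj-sym = λ i j → adj-sym G (e i) (e j)
  ; adj-irr = λ i → adj-irr G (e i)
  }

deletion : ∀ {n} (G : Graph (suc n)) v → IsDeletion G v (G ∘ᴳ punchIn v)
deletion G v =
  punchIn v , Fin.punchIn-injective v _ _ ,
  (λ u u≢v → punchOut (u≢v ∘ sym) , Fin.punchIn-punchOut (u≢v ∘ sym)) ,
  Fin.punchInᵢ≢i v , (λ _ _ → refl)

induced-tMinor : ∀ {n m} {G : Graph n} (H : Graph m) → TMinor G H → (S : Fin m → Bool) →
                 ∃[ k ] Σ (Fin k → Fin m) λ e → Injective _≡_ _≡_ e × TMinor G (H ∘ᴳ e) ×
                   (∀ i → S (e i) ≡ true) × size S ≤ k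
induced-tMinor {m = zero} H H≼G S = 0 , id , id , H≼G , (λ ()) , z≤n
induced-tMinor {m = suc m} H H≼G S with Fin.any? (λ v → S v Bool.≟ false)
... | no  ¬outside = suc m , id , id , H≼G , (λ v → ¬-not (¬outside ∘ (v ,_))) , size≤n S
... | yes (v , Sv)
  with k , e , e-injective , H-v≼G , e∈S , |S-v|≤k
         ← induced-tMinor (H ∘ᴳ punchIn v) (del v H≼G (deletion H v)) (S ∘ punchIn v)
  = k , punchIn v ∘ e , e-injective ∘ Fin.punchIn-injective v _ _ , H-v≼G , e∈S ,
    subst (_≤ k) (sym (size-punchIn S v Sv)) |S-v|≤k

complement-adj : ∀ {n} (G : Graph n) {u v} → u ≢ v → adj (complement G) u v ≡ not (adj G u v)
complement-adj G {u} {v} u≢v with u Fin.≟ v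
... | yes u≡v = contradiction u≡v u≢v
... | no  _   = refl

complement-complete : ∀ {n k} (G : Graph n) {e : Fin k → Fin n} → Injective _≡_ _≡_ e →
                      (∀ i j → adj G (e i) (e j) ≡ false) → IsComplete (complement G ∘ᴳ e)
complement-complete G e-injective independent i j i≢j =
  trans (complement-adj G (i≢j ∘ e-injective)) (cong not (independent i j))

corollary8 : ∀ {n : ℕ} (G : Graph n) → IsCore G → ContainsInducedC5 G → n ≤ 10
corollary8 {zero}  _ _ _ = z≤n
corollary8 {suc m} G (G-core , Gᶜ-core) _
  with S , S-independent , m≤3|S| ← tPerfect⇒largeIndependentSet (G ∘ᴳ suc)
                                      (G-core _ (del zero here (deletion G zero)) ℕₚ.≤-refl)
  with k , e , e-injective , K≼Gᶜ , e∈S , |S|≤k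
         ← induced-tMinor (complement G ∘ᴳ suc) (del zero here (deletion (complement G) zero)) S
  = s≤s (begin
    m           ≤⟨ m≤3|S| ⟩
    3 * size S  ≤⟨ ℕₚ.*-monoʳ-≤ 3 |S|≤k ⟩
    3 * k       ≤⟨ ℕₚ.*-monoʳ-≤ 3 k≤3 ⟩
    9           ∎)
  where
  open ℕₚ.≤-Reasoning
  k≤3 : k ≤ 3
  k≤3 = complete-tPerfect⇒≤3 ((complement G ∘ᴳ suc) ∘ᴳ e)
          (complement-complete G (e-injective ∘ Fin.suc-injective) (λ i j → S-independent _ _ (e∈S i) (e∈S j)))
          (Gᶜ-core _ K≼Gᶜ (s≤s (Fin.injective⇒≤ e-injective)))
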